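{- For every string $s \in \Sigma^*$, $\mathcal{F}^{ -1}\bigl(\mathcal{F}(s)\bigr) = s$.
   Context: Let $\Sigma$ be an alphabet and let $\texttt{@}$ and $\texttt{\$}$ be two distinct symbols not in $\Sigma$. For $s \in \Sigma^*$ with $|s| = n$, let $\hat{s} = \texttt{@}\, s\, \texttt{\$}$ (length $n+2$). The leading run of a non-empty string $w$ is its longest prefix consisting of a single repeated symbol; the trailing run is its longest suffix consisting of a single repeated symbol. A bilateral token is a pair $\tau = (\sigma, p)$ with $\sigma$ a non-empty string and $p \in \mathbb{N}_0$ (the split position); it is terminal if $p = 0$. The Flashback decomposition $\mathcal{F}(s) = [\tau_0, \ldots, \tau_{k-1}]$ is produced as follows, starting with active span $\hat{s}$: (i) if the active span is empty, stop; (ii) let $\ell$ be the length of its leading run; if $\ell$ equals the length of the span, append (span, $0$) and stop; (iii) otherwise let $\sigma$ be the leading run followed by the trailing run, and let the middle be the span with its leading and trailing runs removed; if the middle is empty append $(\sigma, 0)$ and stop, otherwise append $(\sigma, \ell)$ and continue with the middle as the new active span. For a token sequence $T = [(\sigma_0,p_0), \ldots, (\sigma_{k-1},p_{k-1})]$, define $N_{k-1} = \sigma_{k-1}$ and, for $i < k-1$, $N_i = \sigma_i[1..p_i] \cdot N_{i+1} \cdot \sigma_i[p_i+1..|\sigma_i|]$ (1-indexed inclusive substrings); the reconstruction $\mathcal{F}^{ -1}(T)$ is $N_0$ with its first and last characters removed. -}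

module Defs where

open import Data.Nat using (ℕ; zero; suc; _∸_)
open import Data.List using (List; []; _∷_; _++_; length; take; drop; reverse; map)
open import Data.Product using (_×_; _,_)
open import Relation.Nullary using (yes; no)
open import Relation.Binary.Definitions using (DecidableEquality)

data Sym (A : Set) : Set where
  at     : Sym A
  dollar : Sym A
  ch     : A → Sym A

hat : {A : Set} → List A → List (Sym A)
hat s = at ∷ (map ch s ++ dollar ∷ [])

module _ {B : Set} (_≟_ : DecidableEquality B) where

  runFrom : B → List B → ℕ
  runFrom c []      = zero
  runFrom c (x ∷ w) with c ≟ x
  ... | yes _ = suc (runFrom c w)
  ... | no  _ = zero

  leadLen : List B → ℕ
  leadLen []      = zero
  leadLen (x ∷ w) = suc (runFrom x w)

  trailLen : List B → ℕ
  trailLen w = leadLen (reverse w)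

  Token : Set
  Token = List B × ℕ

  -- Flashback decomposition of an active span; the fuel argument only
  -- ensures structural termination (the span strictly shrinks at each
  -- step, so fuel = length of the span is always sufficient).
  flashbackSpan : ℕ → List B → List Token
  flashbackSpan zero    span = []
  flashbackSpan (suc f) []   = []
  flashbackSpan (suc f) span@(_ ∷ _) with leadLen span ≟ℕ length span
    where open import Data.Nat using () renaming (_≟_ to _≟ℕ_)
  ... | yes _ = (span , 0) ∷ []
  ... | no  _ =
    let ℓ      = leadLen span
        t      = trailLen span
        n      = length span
        lead   = take ℓ span
        trail  = drop (n ∸ t) span
        σ      = lead ++ trail
        middle = take (n ∸ ℓ ∸ t) (drop ℓ span)
    in helper σ ℓ middle
    where
      helper : List B → ℕ → List B → List Token
      helper σ ℓ []            = (σ , 0) ∷ []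
      helper σ ℓ middle@(_ ∷ _) = (σ , ℓ) ∷ flashbackSpan f middle

  nest : List Token → List B
  nest []                = []
  nest ((σ , p) ∷ [])    = σ
  nest ((σ , p) ∷ T@(_ ∷ _)) = take p σ ++ nest T ++ drop p σ

  strip : List B → List B
  strip w = take (length w ∸ 2) (drop 1 w)

  unflash : List Token → List B
  unflash T = strip (nest T)

module _ {A : Set} (_≟A_ : DecidableEquality A) where
  open import Relation.Binary.PropositionalEquality using (_≡_; refl; cong)

  _≟S_ : DecidableEquality (Sym A)
  at ≟S at = yes refl
  at ≟S dollar = no (λ ())
  at ≟S ch _ = no (λ ())
  dollar ≟S at = no (λ ())
  dollar ≟S dollar = yes refl
  dollar ≟S ch _ = no (λ ())
  ch _ ≟S at = no (λ ())
  ch _ ≟S dollar = no (λ ())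
  ch a ≟S ch b with a ≟A b
  ... | yes refl = yes refl
  ... | no ne = no (λ { refl → ne refl })

  flashback : List A → List (List (Sym A) × ℕ)
  flashback s = flashbackSpan _≟S_ (length (hat s)) (hat s)

  flashback⁻¹ : List (List (Sym A) × ℕ) → List (Sym A)
  flashback⁻¹ = unflash _≟S_

{-# OPTIONS --safe #-}
-- Once the leading run of a span is not the whole span, the run must end at
-- a change point x ≠ y, and no run of the span (read forwards or backwards)
-- can cross that point.  Hence the leading and trailing runs do not overlap,
-- the span is exactly  lead ++ middle ++ trail,  and σ = lead ++ trail splits
-- at position ℓ = |lead| back into lead and trail.  Nesting therefore
-- reassembles every span by induction on the fuel, and stripping the
-- sentinels @ and $ from ŝ gives back s.
module Submission where

open import Data.Nat using (zero; suc; _+_; _∸_; _⊓_; _≤_; s≤s; s≤s⁻¹; z≤n)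
import Data.Nat as ℕ
open import Data.Nat.Properties
open import Data.List using (List; []; _∷_; _++_; _∷ʳ_; length; take; drop; reverse; map)
open import Data.List.Properties
  using (++-assoc; length-++; length-reverse; length-take; length-drop;
         take++drop≡id; drop-drop; reverse-++; ʳ++-defn)
open import Data.Product using (∃₂; _×_; _,_)
open import Function using (_∘_)
open import Relation.Binary.Definitions using (DecidableEquality)
open import Relation.Binary.PropositionalEquality
open import Relation.Nullary using (yes; no)
open import Relation.Nullary.Negation using (contradiction)

open import Defs

module _ {C : Set} where

  length≡⇒take-++≡ : ∀ {n} (xs : List C) {ys} → length xs ≡ n → take n (xs ++ ys) ≡ xs
  length≡⇒take-++≡ []       refl = refl
  length≡⇒take-++≡ (x ∷ xs) refl = cong (x ∷_) (length≡⇒take-++≡ xs refl)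

  length≡⇒drop-++≡ : ∀ {n} (xs : List C) {ys} → length xs ≡ n → drop n (xs ++ ys) ≡ ys
  length≡⇒drop-++≡ []       refl = refl
  length≡⇒drop-++≡ (x ∷ xs) refl = length≡⇒drop-++≡ xs refl

  length-take-≤ : ∀ {n} (xs : List C) → n ≤ length xs → length (take n xs) ≡ n
  length-take-≤ {n} xs n≤len = trans (length-take n xs) (m≤n⇒m⊓n≡m n≤len)

  take++take-drop++drop≡id : ∀ m n (xs : List C) →
                             take m xs ++ take n (drop m xs) ++ drop (m + n) xs ≡ xs
  take++take-drop++drop≡id m n xs = begin
    take m xs ++ take n (drop m xs) ++ drop (m + n) xs
      ≡⟨ cong (λ zs → take m xs ++ take n (drop m xs) ++ zs) (drop-drop m n xs) ⟨
    take m xs ++ take n (drop m xs) ++ drop n (drop m xs)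
      ≡⟨ cong (take m xs ++_) (take++drop≡id n (drop m xs)) ⟩
    take m xs ++ drop m xs
      ≡⟨ take++drop≡id m xs ⟩
    xs ∎
    where open ≡-Reasoning

  take++middle++drop≡id : ∀ {a b} (xs : List C) → a + b ≤ length xs →
    take a xs ++ take (length xs ∸ a ∸ b) (drop a xs) ++ drop (length xs ∸ b) xs ≡ xs
  take++middle++drop≡id {a} {b} xs a+b≤n =
    subst (λ m → take a xs ++ take k (drop a xs) ++ drop m xs ≡ xs)
          a+k≡n∸b (take++take-drop++drop≡id a k xs)
    where
    n = length xs
    k = n ∸ a ∸ b
    a+k≡n∸b : a + k ≡ n ∸ b
    a+k≡n∸b = begin
      a + (n ∸ a ∸ b) ≡⟨ +-∸-assoc a (m+n≤o⇒m≤o∸n b (subst (_≤ n) (+-comm a b) a+b≤n)) ⟨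
      a + (n ∸ a) ∸ b ≡⟨ cong (_∸ b) (m+[n∸m]≡n (m+n≤o⇒m≤o a a+b≤n)) ⟩
      n ∸ b           ∎
      where open ≡-Reasoning

  reverse-++-∷-∷ : ∀ (u : List C) x y v → reverse (u ++ x ∷ y ∷ v) ≡ reverse v ++ y ∷ x ∷ reverse u
  reverse-++-∷-∷ u x y v = begin
    reverse (u ++ x ∷ y ∷ v)              ≡⟨ reverse-++ u (x ∷ y ∷ v) ⟩
    reverse (x ∷ y ∷ v) ++ reverse u      ≡⟨ cong (_++ reverse u) (ʳ++-defn v) ⟩
    (reverse v ++ y ∷ x ∷ []) ++ reverse u ≡⟨ ++-assoc (reverse v) (y ∷ x ∷ []) (reverse u) ⟩
    reverse v ++ y ∷ x ∷ reverse u        ∎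
    where open ≡-Reasoning

module _ {B : Set} (_≟_ : DecidableEquality B) where

  lead trail middle : List B → List B
  lead   w = take (leadLen _≟_ w) w
  trail  w = drop (length w ∸ trailLen _≟_ w) w
  middle w = take (length w ∸ leadLen _≟_ w ∸ trailLen _≟_ w) (drop (leadLen _≟_ w) w)

  runFrom-≤-change : ∀ c u {x y} v → x ≢ y → runFrom _≟_ c (u ++ x ∷ y ∷ v) ≤ suc (length u)
  runFrom-≤-change c []      {x} {y} v x≢y with c ≟ x
  ... | no _     = z≤n
  ... | yes refl with c ≟ y
  ...   | yes refl = contradiction refl x≢y
  ...   | no _     = s≤s z≤n
  runFrom-≤-change c (z ∷ u) v x≢y with c ≟ z
  ... | yes _ = s≤s (runFrom-≤-change c u v x≢y)
  ... | no _  = z≤n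

  leadLen-≤-change : ∀ u {x y} v → x ≢ y → leadLen _≟_ (u ++ x ∷ y ∷ v) ≤ suc (length u)
  leadLen-≤-change []      {x} {y} v x≢y with x ≟ y
  ... | yes x≡y = contradiction x≡y x≢y
  ... | no _    = s≤s z≤n
  leadLen-≤-change (z ∷ u) v x≢y = s≤s (runFrom-≤-change z u v x≢y)

  trailLen-≤-change : ∀ u {x y} v → x ≢ y → trailLen _≟_ (u ++ x ∷ y ∷ v) ≤ suc (length v)
  trailLen-≤-change u {x} {y} v x≢y = begin
    leadLen _≟_ (reverse (u ++ x ∷ y ∷ v))       ≡⟨ cong (leadLen _≟_) (reverse-++-∷-∷ u x y v) ⟩
    leadLen _≟_ (reverse v ++ y ∷ x ∷ reverse u) ≤⟨ leadLen-≤-change (reverse v) (reverse u) (x≢y ∘ sym) ⟩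
    suc (length (reverse v))                     ≡⟨ cong suc (length-reverse v) ⟩
    suc (length v)                               ∎
    where open ≤-Reasoning

  change-point : ∀ c w → leadLen _≟_ (c ∷ w) ≢ length (c ∷ w) →
                 ∃₂ λ u v → ∃₂ λ x y → c ∷ w ≡ u ++ x ∷ y ∷ v × x ≢ y
  change-point c []      ℓ≢n = contradiction refl ℓ≢n
  change-point c (z ∷ w) ℓ≢n with c ≟ z
  ... | no c≢z   = [] , w , c , z , refl , c≢z
  ... | yes refl with change-point c w (ℓ≢n ∘ cong suc)
  ...   | u , v , x , y , c∷w≡ , x≢y = c ∷ u , v , x , y , cong (c ∷_) c∷w≡ , x≢y

  leadLen+trailLen≤length-change : ∀ u {x y} v → x ≢ y → let w = u ++ x ∷ y ∷ v in
                                   leadLen _≟_ w + trailLen _≟_ w ≤ length w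
  leadLen+trailLen≤length-change u {x} {y} v x≢y = begin
    leadLen _≟_ w + trailLen _≟_ w   ≤⟨ +-mono-≤ (leadLen-≤-change u v x≢y) (trailLen-≤-change u v x≢y) ⟩
    suc (length u) + suc (length v)  ≡⟨ +-suc (length u) (suc (length v)) ⟨
    length u + length (x ∷ y ∷ v)    ≡⟨ length-++ u ⟨
    length w                         ∎
    where
    open ≤-Reasoning
    w = u ++ x ∷ y ∷ v

  leadLen+trailLen≤length : ∀ w → leadLen _≟_ w ≢ length w →
                            leadLen _≟_ w + trailLen _≟_ w ≤ length w
  leadLen+trailLen≤length []      ℓ≢n = contradiction refl ℓ≢n
  leadLen+trailLen≤length (c ∷ w) ℓ≢n with change-point c w ℓ≢n
  ... | u , v , x , y , c∷w≡ , x≢y =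
    subst (λ w → leadLen _≟_ w + trailLen _≟_ w ≤ length w) (sym c∷w≡)
          (leadLen+trailLen≤length-change u v x≢y)

  lead++middle++trail≡id : ∀ w → leadLen _≟_ w ≢ length w → lead w ++ middle w ++ trail w ≡ w
  lead++middle++trail≡id w ℓ≢n =
    take++middle++drop≡id {a = leadLen _≟_ w} {b = trailLen _≟_ w} w (leadLen+trailLen≤length w ℓ≢n)

  middle-shorter : ∀ x xs → length (middle (x ∷ xs)) ≤ length xs
  middle-shorter x xs = begin
    length (take k (drop r xs)) ≡⟨ length-take k (drop r xs) ⟩
    k ⊓ length (drop r xs)      ≤⟨ m⊓n≤n k _ ⟩
    length (drop r xs)          ≡⟨ length-drop r xs ⟩
    length xs ∸ r               ≤⟨ m∸n≤m (length xs) r ⟩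
    length xs                   ∎
    where
    open ≤-Reasoning
    r = runFrom _≟_ x xs
    k = length xs ∸ r ∸ trailLen _≟_ (x ∷ xs)

  nest-∷ : ∀ σ p T {ys} → nest _≟_ T ≡ ys → ys ≢ [] →
           nest _≟_ ((σ , p) ∷ T) ≡ take p σ ++ ys ++ drop p σ
  nest-∷ σ p []      refl []≢[] = contradiction refl []≢[]
  nest-∷ σ p (_ ∷ _) refl _     = refl

  nest-flashbackSpan : ∀ f w → length w ≤ f → nest _≟_ (flashbackSpan _≟_ f w) ≡ w
  nest-flashbackSpan zero    []         _        = refl
  nest-flashbackSpan (suc f) []         _        = refl
  nest-flashbackSpan (suc f) w@(x ∷ xs) |w|≤1+f with leadLen _≟_ w ℕ.≟ length w
  ... | yes _   = refl
  ... | no ℓ≢n with middle w in middle≡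
  ...   | []     = trans (cong (λ m → lead w ++ m ++ trail w) (sym middle≡))
                         (lead++middle++trail≡id w ℓ≢n)
  ...   | m ∷ ms = begin
    nest _≟_ ((σ , ℓ) ∷ flashbackSpan _≟_ f (m ∷ ms))
      ≡⟨ nest-∷ σ ℓ (flashbackSpan _≟_ f (m ∷ ms)) (nest-flashbackSpan f (m ∷ ms) |middle|≤f) (λ ()) ⟩
    take ℓ σ ++ (m ∷ ms) ++ drop ℓ σ
      ≡⟨ cong₂ (λ l t → l ++ (m ∷ ms) ++ t)
               (length≡⇒take-++≡ (lead w) |lead|≡ℓ) (length≡⇒drop-++≡ (lead w) |lead|≡ℓ) ⟩
    lead w ++ (m ∷ ms) ++ trail w
      ≡⟨ cong (λ m → lead w ++ m ++ trail w) middle≡ ⟨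
    lead w ++ middle w ++ trail w
      ≡⟨ lead++middle++trail≡id w ℓ≢n ⟩
    w ∎
    where
    open ≡-Reasoning
    ℓ = leadLen _≟_ w
    σ = lead w ++ trail w
    |lead|≡ℓ : length (lead w) ≡ ℓ
    |lead|≡ℓ = length-take-≤ w (m+n≤o⇒m≤o ℓ (leadLen+trailLen≤length w ℓ≢n))
    |middle|≤f : length (m ∷ ms) ≤ f
    |middle|≤f = subst (λ m → length m ≤ f) middle≡ (≤-trans (middle-shorter x xs) (s≤s⁻¹ |w|≤1+f))

  strip-∷-∷ʳ : ∀ x u y → strip _≟_ (x ∷ u ∷ʳ y) ≡ u
  strip-∷-∷ʳ x u y = length≡⇒take-++≡ u (begin
    length u                 ≡⟨ m+n∸n≡m (length u) 1 ⟨
    length u + 1 ∸ 1         ≡⟨ cong (_∸ 1) (length-++ u) ⟨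
    length (u ∷ʳ y) ∸ 1      ∎)
    where open ≡-Reasoning

mainTheorem1 : {A : Set} (_≟_ : DecidableEquality A) (s : List A) →
               flashback⁻¹ _≟_ (flashback _≟_ s) ≡ map ch s
mainTheorem1 {A} _≟_ s = begin
  strip _≟S′_ (nest _≟S′_ (flashbackSpan _≟S′_ (length (hat s)) (hat s)))
    ≡⟨ cong (strip _≟S′_) (nest-flashbackSpan _≟S′_ (length (hat s)) (hat s) ≤-refl) ⟩
  strip _≟S′_ (hat s)
    ≡⟨ strip-∷-∷ʳ _≟S′_ at (map ch s) dollar ⟩
  map ch s ∎
  where
  open ≡-Reasoning
  _≟S′_ : DecidableEquality (Sym A)
  _≟S′_ = _≟S_ _≟_
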